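{- Let $k\ge1$ and let $F_n^k(\mathbf z;q)=\sum_{\pi\in PRLP_n^k}\big(\prod_j z_{\ell_j}\big)q^{\mathrm{inv}(\pi)}$ as in the context. Then $F_0^k(\mathbf z;q)=1$ and for $n\ge1$ $$F_n^k(\mathbf z;q)=\sum_{i=1}^k z_i\,q^{\binom{i-1}{2}+i(n-i)}F_{n-i}^k(\mathbf z;q),$$ where $F_n^k(\mathbf z;q)=0$ for $n<0$.
   Context: For a composition $(\ell_1,\dots,\ell_r)$ of $n$, the layered permutation of $[n]$ has first $\ell_1$ entries the $\ell_1$ largest elements of $[n]$ in increasing order, next $\ell_2$ entries the next largest $\ell_2$ elements in increasing order, etc. (its layers). The associated partially reversed layered permutation is obtained by reversing the first $\ell_j-1$ entries of each layer, i.e. a layer with values $a,a+1,\dots,a+\ell-1$ becomes $a+\ell-2,a+\ell-3,\dots,a,a+\ell-1$; the layer lengths are still $\ell_1,\dots,\ell_r$. $PRLP_n^k$ is the set of such permutations of $[n]$ with all layers of length at most $k$. $\mathbf z=(z_1,\dots,z_k)$ are indeterminates and $\mathrm{inv}$ is the inversion number. -}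

module Defs where

open import Data.Nat using (ℕ; zero; suc; _∸_; _≤_; _<_; _<?_; _≤?_)
import Data.Nat as N
open import Data.Nat.Combinatorics using (_C_)
open import Data.Fin using (Fin; fromℕ<)
open import Data.List using (List; []; _∷_; _++_; map; concatMap; reverse; foldr; length; filter)
open import Data.Bool using (Bool; true; false; if_then_else_)
open import Relation.Nullary using (yes; no)
open import Algebra.Bundles using (CommutativeRing)
open import Level using (Level)

range : ℕ → ℕ → List ℕ
range a zero    = []
range a (suc m) = a ∷ range (suc a) m

-- Compositions of n with all parts in {1,...,k}, listed (ℓ₁, ..., ℓ_r).
-- The first argument is fuel; fuel ≥ n suffices since every part is ≥ 1.
compsFuel : ℕ → ℕ → ℕ → List (List ℕ)
compsFuel k zero    zero    = [] ∷ []
compsFuel k zero    (suc n) = []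
compsFuel k (suc f) zero    = [] ∷ []
compsFuel k (suc f) (suc n) =
  concatMap (λ i → part i (i ≤? suc n)) (range 1 k)
  where
  part : (i : ℕ) → _ → List (List ℕ)
  part i (yes _) = map (i ∷_) (compsFuel k f (suc n ∸ i))
  part i (no _)  = []

compositions : ℕ → ℕ → List (List ℕ)
compositions k n = compsFuel k n n

prLayer : ℕ → ℕ → List ℕ
prLayer a zero    = []
prLayer a (suc m) = reverse (range a m) ++ (a N.+ m ∷ [])

-- Partially reversed layered permutation of [n] = {1..n} (one-line notation)
-- for composition (ℓ₁, ..., ℓ_r): the first layer uses the ℓ₁ largest values, etc.
prlp : ℕ → List ℕ → List ℕ
prlp n []       = []
prlp n (ℓ ∷ ls) = prLayer (suc (n ∸ ℓ)) ℓ ++ prlp (n ∸ ℓ) ls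

countLess : ℕ → List ℕ → ℕ
countLess x []       = 0
countLess x (y ∷ ys) with y <? x
... | yes _ = suc (countLess x ys)
... | no  _ = countLess x ys

inv : List ℕ → ℕ
inv []       = 0
inv (x ∷ xs) = countLess x xs N.+ inv xs

-- PRLP_n^k, as the list of (composition, permutation) pairs; the map
-- composition ↦ permutation is injective, so this enumerates PRLP_n^k.
module Poly {c ℓ : Level} (R : CommutativeRing c ℓ) where
  open CommutativeRing R

  pow : Carrier → ℕ → Carrier
  pow x zero    = 1#
  pow x (suc m) = x * pow x m

  sumR : List Carrier → Carrier
  sumR = foldr _+_ 0#

  prodR : List Carrier → Carrier
  prodR = foldr _*_ 1#

  -- z_ℓ for 1 ≤ ℓ ≤ k, with z : Fin k → R (z_ℓ = z (ℓ-1)); 0 outside range (never used)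
  zAt : {k : ℕ} → (Fin k → Carrier) → ℕ → Carrier
  zAt {k} z zero    = 0#
  zAt {k} z (suc m) with m <? k
  ... | yes p = z (fromℕ< p)
  ... | no  _ = 0#

  F : (k : ℕ) → (Fin k → Carrier) → Carrier → ℕ → Carrier
  F k z q n =
    sumR (map (λ ls → prodR (map (zAt z) ls) * pow q (inv (prlp n ls)))
              (compositions k n))

  recTerm : (k : ℕ) → (Fin k → Carrier) → Carrier → ℕ → ℕ → Carrier
  recTerm k z q n i with i ≤? n
  ... | yes _ = zAt z i * pow q (((i ∸ 1) C 2) N.+ i N.* (n ∸ i)) * F k z q (n ∸ i)
  ... | no  _ = 0#

  recSum : (k : ℕ) → (Fin k → Carrier) → Carrier → ℕ → Carrier
  recSum k z q n = sumR (map (recTerm k z q n) (range 1 k))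

module Submission where

-- Group the compositions of n by their first part i.  For the composition
-- (i, ls), the word prlp n (i ∷ ls) is the layer prLayer (n-i+1) i followed
-- by prlp (n-i) ls.  Its inversions split (inv-++) into
--   * those inside the layer: a decreasing run of length i-1 followed by its
--     maximum, giving C(i-1,2) (inv-prLayer);
--   * those across: every layer entry exceeds each of the n-i later entries,
--     giving i(n-i) (cross-all);
--   * those of prlp (n-i) ls.
-- So each composition's weight factors (weight-cons), and the block of
-- compositions with first part i sums to the i-th term of the recurrence.

open import Defs
open import Data.Nat using (ℕ; _≤_)
open import Data.Fin using (Fin)
open import Data.Product using (_×_)
open import Algebra.Bundles using (CommutativeRing)
open import Level using (Level)
open import Data.Nat using (suc)
open import Data.Product using (_,_)

module LayeredPermutations where
  open import Data.Nat using (zero; suc; _+_; _*_; _∸_; _<_; _≤?_; _<?_; s≤s)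
  open import Data.Nat.Properties
  open import Data.Nat.Combinatorics using (_C_; nC1≡n; nCk+nC[k+1]≡[n+1]C[k+1])
  open import Data.Nat.ListAction using (sum)
  open import Data.Nat.Tactic.RingSolver using (solve-∀)
  open import Data.List using (List; []; _∷_; _++_; [_]; map; concatMap; reverse; length)
  open import Data.List.Properties using (concatMap-cong; length-++; reverse-++)
  import Data.List.Relation.Unary.All as All
  open All using (All; []; _∷_)
  open import Data.List.Relation.Unary.All.Properties using (++⁺; map⁺; concat⁺)
  open import Relation.Nullary using (Dec; yes; no)
  open import Relation.Nullary.Negation using (contradiction)
  open import Relation.Binary.PropositionalEquality using (_≡_; refl; sym; trans; cong; cong₂; subst; module ≡-Reasoning)

  -- Compositions of suc n (fuel suc f) whose first part is i; this is the
  -- case split that compsFuel performs through a helper private to Defs.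
  firstPart : (k f n i : ℕ) → Dec (i ≤ suc n) → List (List ℕ)
  firstPart k f n i (yes _) = map (i ∷_) (compsFuel k f (suc n ∸ i))
  firstPart k f n i (no _)  = []

  -- The private helper of Defs cannot be named, so the left-hand side of
  -- firstPart-unfold is left to unification with the use in compsFuel-suc.
  mutual
    compsFuel-suc : ∀ k f n →
      compsFuel k (suc f) (suc n) ≡ concatMap (λ i → firstPart k f n i (i ≤? suc n)) (range 1 k)
    compsFuel-suc k f n = concatMap-cong (firstPart-unfold k f n) (range 1 k)

    firstPart-unfold : ∀ k f n i → _ ≡ firstPart k f n i (i ≤? suc n)
    firstPart-unfold k f n i with i ≤? suc n
    ... | yes _ = refl
    ... | no  _ = refl

  concatMap-cong-range : ∀ {B : Set} {g h : ℕ → List B} a m → (∀ i → a ≤ i → g i ≡ h i) →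
    concatMap g (range a m) ≡ concatMap h (range a m)
  concatMap-cong-range a zero    g≡h = refl
  concatMap-cong-range a (suc m) g≡h =
    cong₂ _++_ (g≡h a ≤-refl) (concatMap-cong-range (suc a) m (λ i a<i → g≡h i (≤-trans (n≤1+n a) a<i)))

  compsFuel-zero : ∀ k f → compsFuel k f 0 ≡ [ [] ]
  compsFuel-zero k zero    = refl
  compsFuel-zero k (suc f) = refl

  -- Since every part is ≥ 1, any fuel f ≥ n produces the same list of compositions.
  fuel-irrelevant : ∀ k {f g} n → n ≤ f → n ≤ g → compsFuel k f n ≡ compsFuel k g n
  fuel-irrelevant k {f} {g} zero _ _ = trans (compsFuel-zero k f) (sym (compsFuel-zero k g))
  fuel-irrelevant k {suc f} {suc g} (suc n) (s≤s n≤f) (s≤s n≤g) = begin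
    compsFuel k (suc f) (suc n)                                   ≡⟨ compsFuel-suc k f n ⟩
    concatMap (λ i → firstPart k f n i (i ≤? suc n)) (range 1 k) ≡⟨ concatMap-cong-range 1 k samePart ⟩
    concatMap (λ i → firstPart k g n i (i ≤? suc n)) (range 1 k) ≡⟨ compsFuel-suc k g n ⟨
    compsFuel k (suc g) (suc n)                                   ∎
    where
    open ≡-Reasoning
    samePart : ∀ i → 1 ≤ i → firstPart k f n i (i ≤? suc n) ≡ firstPart k g n i (i ≤? suc n)
    samePart (suc j) _ with suc j ≤? suc n
    ... | yes _ = cong (map (suc j ∷_))
                    (fuel-irrelevant k (n ∸ j) (≤-trans (m∸n≤m n j) n≤f) (≤-trans (m∸n≤m n j) n≤g))
    ... | no  _ = refl

  compsFuel-sum : ∀ k f n → All (λ ls → sum ls ≡ n) (compsFuel k f n)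
  compsFuel-sum k zero    zero    = refl ∷ []
  compsFuel-sum k zero    (suc n) = []
  compsFuel-sum k (suc f) zero    = refl ∷ []
  compsFuel-sum k (suc f) (suc n) =
    subst (All _) (sym (compsFuel-suc k f n))
      (concat⁺ (map⁺ (All.universal (λ i → partSum i (i ≤? suc n)) (range 1 k))))
    where
    partSum : ∀ i d → All (λ ls → sum ls ≡ suc n) (firstPart k f n i d)
    partSum i (yes i≤n) = map⁺ (All.map (λ e → trans (cong (i +_) e) (m+[n∸m]≡n i≤n))
                                         (compsFuel-sum k f (suc n ∸ i)))
    partSum i (no  _)   = []

  compositions-sum : ∀ k n → All (λ ls → sum ls ≡ n) (compositions k n)
  compositions-sum k n = compsFuel-sum k n n

  cross : List ℕ → List ℕ → ℕ
  cross []       ys = 0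
  cross (x ∷ xs) ys = countLess x ys + cross xs ys

  countLess-++ : ∀ x xs ys → countLess x (xs ++ ys) ≡ countLess x xs + countLess x ys
  countLess-++ x []       ys = refl
  countLess-++ x (y ∷ xs) ys with y <? x
  ... | yes _ = cong suc (countLess-++ x xs ys)
  ... | no  _ = countLess-++ x xs ys

  inv-++ : ∀ xs ys → inv (xs ++ ys) ≡ inv xs + cross xs ys + inv ys
  inv-++ []       ys = refl
  inv-++ (x ∷ xs) ys = begin
    countLess x (xs ++ ys) + inv (xs ++ ys)
      ≡⟨ cong₂ _+_ (countLess-++ x xs ys) (inv-++ xs ys) ⟩
    (countLess x xs + countLess x ys) + (inv xs + cross xs ys + inv ys)
      ≡⟨ regroup (countLess x xs) (countLess x ys) (inv xs) (cross xs ys) (inv ys) ⟩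
    countLess x xs + inv xs + (countLess x ys + cross xs ys) + inv ys ∎
    where
    open ≡-Reasoning
    regroup : ∀ a b c d e → (a + b) + (c + d + e) ≡ a + c + (b + d) + e
    regroup = solve-∀

  countLess-all : ∀ x ys → All (_< x) ys → countLess x ys ≡ length ys
  countLess-all x []       []         = refl
  countLess-all x (y ∷ ys) (y<x ∷ ps) with y <? x
  ... | yes _   = cong suc (countLess-all x ys ps)
  ... | no  y≮x = contradiction y<x y≮x

  countLess-none : ∀ x ys → All (x ≤_) ys → countLess x ys ≡ 0
  countLess-none x []       []         = refl
  countLess-none x (y ∷ ys) (x≤y ∷ ps) with y <? x
  ... | yes y<x = contradiction x≤y (<⇒≱ y<x)
  ... | no  _   = countLess-none x ys ps

  cross-all : ∀ b xs ys → All (b <_) xs → All (_≤ b) ys → cross xs ys ≡ length xs * length ys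
  cross-all b []       ys []         _   = refl
  cross-all b (x ∷ xs) ys (b<x ∷ ps) ys≤b =
    cong₂ _+_ (countLess-all x ys (All.map (λ y≤b → <-≤-trans (s≤s y≤b) b<x) ys≤b))
              (cross-all b xs ys ps ys≤b)

  cross-none : ∀ b xs ys → All (_≤ b) xs → All (b ≤_) ys → cross xs ys ≡ 0
  cross-none b []       ys []         _   = refl
  cross-none b (x ∷ xs) ys (x≤b ∷ ps) b≤ys =
    cong₂ _+_ (countLess-none x ys (All.map (≤-trans x≤b) b≤ys)) (cross-none b xs ys ps b≤ys)

  descending : ℕ → ℕ → List ℕ
  descending a zero    = []
  descending a (suc j) = a + j ∷ descending a j

  range-snoc : ∀ a j → range a (suc j) ≡ range a j ++ [ a + j ]
  range-snoc a zero    = cong [_] (sym (+-identityʳ a))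
  range-snoc a (suc j) = cong (a ∷_) (trans (range-snoc (suc a) j) (cong (λ t → range (suc a) j ++ [ t ]) (sym (+-suc a j))))

  reverse-range : ∀ a j → reverse (range a j) ≡ descending a j
  reverse-range a zero    = refl
  reverse-range a (suc j) = begin
    reverse (range a (suc j))       ≡⟨ cong reverse (range-snoc a j) ⟩
    reverse (range a j ++ [ a + j ]) ≡⟨ reverse-++ (range a j) [ a + j ] ⟩
    a + j ∷ reverse (range a j)      ≡⟨ cong (a + j ∷_) (reverse-range a j) ⟩
    descending a (suc j)             ∎
    where open ≡-Reasoning

  descending-< : ∀ a j → All (_< a + j) (descending a j)
  descending-< a zero    = []
  descending-< a (suc j) =
    +-monoʳ-< a (n<1+n j) ∷ All.map (λ y<a+j → <-≤-trans y<a+j (+-monoʳ-≤ a (n≤1+n j))) (descending-< a j)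

  descending-≥ : ∀ a j → All (a ≤_) (descending a j)
  descending-≥ a zero    = []
  descending-≥ a (suc j) = m≤m+n a j ∷ descending-≥ a j

  length-descending : ∀ a j → length (descending a j) ≡ j
  length-descending a zero    = refl
  length-descending a (suc j) = cong suc (length-descending a j)

  inv-descending : ∀ a j → inv (descending a j) ≡ j C 2
  inv-descending a zero    = refl
  inv-descending a (suc j) = begin
    countLess (a + j) (descending a j) + inv (descending a j)
      ≡⟨ cong₂ _+_ (trans (countLess-all (a + j) (descending a j) (descending-< a j)) (length-descending a j))
                   (inv-descending a j) ⟩
    j + j C 2     ≡⟨ cong (_+ j C 2) (nC1≡n j) ⟨
    j C 1 + j C 2 ≡⟨ nCk+nC[k+1]≡[n+1]C[k+1] j 1 ⟩
    suc j C 2     ∎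
    where open ≡-Reasoning

  prLayer-suc : ∀ a j → prLayer a (suc j) ≡ descending a j ++ [ a + j ]
  prLayer-suc a j = cong (_++ [ a + j ]) (reverse-range a j)

  inv-prLayer : ∀ a j → inv (prLayer a (suc j)) ≡ j C 2
  inv-prLayer a j = begin
    inv (prLayer a (suc j))                                        ≡⟨ cong inv (prLayer-suc a j) ⟩
    inv (descending a j ++ [ a + j ])                              ≡⟨ inv-++ (descending a j) [ a + j ] ⟩
    inv (descending a j) + cross (descending a j) [ a + j ] + 0
      ≡⟨ cong₂ (λ u v → u + v + 0) (inv-descending a j)
           (cross-none (a + j) (descending a j) [ a + j ] (All.map <⇒≤ (descending-< a j)) (≤-refl ∷ [])) ⟩
    j C 2 + 0 + 0                                                  ≡⟨ trans (+-identityʳ _) (+-identityʳ _) ⟩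
    j C 2                                                          ∎
    where open ≡-Reasoning

  length-prLayer : ∀ a ℓ → length (prLayer a ℓ) ≡ ℓ
  length-prLayer a zero    = refl
  length-prLayer a (suc j) = begin
    length (prLayer a (suc j))              ≡⟨ cong length (prLayer-suc a j) ⟩
    length (descending a j ++ [ a + j ])    ≡⟨ length-++ (descending a j) ⟩
    length (descending a j) + 1             ≡⟨ cong (_+ 1) (length-descending a j) ⟩
    j + 1                                   ≡⟨ +-comm j 1 ⟩
    suc j                                   ∎
    where open ≡-Reasoning

  prLayer-≥ : ∀ a ℓ → All (a ≤_) (prLayer a ℓ)
  prLayer-≥ a zero    = []
  prLayer-≥ a (suc j) = subst (All (a ≤_)) (sym (prLayer-suc a j)) (++⁺ (descending-≥ a j) (m≤m+n a j ∷ []))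

  prLayer-< : ∀ a ℓ → All (_< a + ℓ) (prLayer a ℓ)
  prLayer-< a zero    = []
  prLayer-< a (suc j) = subst (All (_< a + suc j)) (sym (prLayer-suc a j))
    (++⁺ (All.map (λ y<a+j → <-≤-trans y<a+j (+-monoʳ-≤ a (n≤1+n j))) (descending-< a j))
         (+-monoʳ-< a (n<1+n j) ∷ []))

  length-prlp : ∀ ls {m} → sum ls ≡ m → length (prlp m ls) ≡ m
  length-prlp []       refl = refl
  length-prlp (ℓ ∷ ls) refl rewrite m+n∸m≡n ℓ (sum ls) = begin
    length (prLayer (suc (sum ls)) ℓ ++ prlp (sum ls) ls)
      ≡⟨ length-++ (prLayer (suc (sum ls)) ℓ) ⟩
    length (prLayer (suc (sum ls)) ℓ) + length (prlp (sum ls) ls)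
      ≡⟨ cong₂ _+_ (length-prLayer (suc (sum ls)) ℓ) (length-prlp ls refl) ⟩
    ℓ + sum ls ∎
    where open ≡-Reasoning

  prlp-≤ : ∀ ls {m} → sum ls ≡ m → All (_≤ m) (prlp m ls)
  prlp-≤ []       refl = []
  prlp-≤ (ℓ ∷ ls) refl rewrite m+n∸m≡n ℓ (sum ls) =
    ++⁺ (All.map (λ y<top → ≤-pred (<-≤-trans y<top (≤-reflexive (cong suc (+-comm (sum ls) ℓ)))))
                 (prLayer-< (suc (sum ls)) ℓ))
        (All.map (λ y≤s → ≤-trans y≤s (m≤n+m (sum ls) ℓ)) (prlp-≤ ls refl))

  -- Peeling off the first layer (of length suc j) of prlp n: its internal
  -- inversions, plus every entry of it exceeding each of the n ∸ suc j later entries.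
  inv-prlp-cons : ∀ n j ls → sum ls ≡ n ∸ suc j →
    inv (prlp n (suc j ∷ ls)) ≡ j C 2 + suc j * (n ∸ suc j) + inv (prlp (n ∸ suc j) ls)
  inv-prlp-cons n j ls sum≡b = begin
    inv (layer ++ rest)                       ≡⟨ inv-++ layer rest ⟩
    inv layer + cross layer rest + inv rest
      ≡⟨ cong₂ (λ u v → u + v + inv rest) (inv-prLayer (suc b) j)
           (trans (cross-all b layer rest (prLayer-≥ (suc b) (suc j)) (prlp-≤ ls sum≡b))
                  (cong₂ _*_ (length-prLayer (suc b) (suc j)) (length-prlp ls sum≡b))) ⟩
    j C 2 + suc j * b + inv rest              ∎
    where
    open ≡-Reasoning
    b : ℕ
    b = n ∸ suc j
    layer rest : List ℕ
    layer = prLayer (suc b) (suc j)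
    rest  = prlp b ls

open LayeredPermutations

module RingSums {c ℓ : Level} (R : CommutativeRing c ℓ) where
  import Data.Nat as ℕ
  open import Data.Nat using (zero; suc)
  open import Data.Nat.Properties using (≤-refl; ≤-trans; n≤1+n)
  open import Data.List using (List; []; _∷_; _++_; map; concatMap)
  open import Data.List.Properties using (map-++)
  open import Data.List.Relation.Unary.All using (All; []; _∷_)
  import Relation.Binary.PropositionalEquality as P
  open CommutativeRing R
  open Poly R
  open import Relation.Binary.Reasoning.Setoid setoid

  sumR-++ : ∀ xs ys → sumR (xs ++ ys) ≈ sumR xs + sumR ys
  sumR-++ []       ys = sym (+-identityˡ _)
  sumR-++ (x ∷ xs) ys = trans (+-congˡ (sumR-++ xs ys)) (sym (+-assoc _ _ _))

  sumR-concatMap : ∀ {A B : Set} (f : B → Carrier) (g : A → List B) xs →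
    sumR (map f (concatMap g xs)) ≈ sumR (map (λ x → sumR (map f (g x))) xs)
  sumR-concatMap f g []       = refl
  sumR-concatMap f g (x ∷ xs) = begin
    sumR (map f (g x ++ concatMap g xs))                 ≡⟨ P.cong sumR (map-++ f (g x) (concatMap g xs)) ⟩
    sumR (map f (g x) ++ map f (concatMap g xs))         ≈⟨ sumR-++ (map f (g x)) _ ⟩
    sumR (map f (g x)) + sumR (map f (concatMap g xs))   ≈⟨ +-congˡ (sumR-concatMap f g xs) ⟩
    sumR (map f (g x)) + sumR (map (λ y → sumR (map f (g y))) xs) ∎

  sumR-cong-range : ∀ {f h : ℕ → Carrier} a m → (∀ i → a ≤ i → f i ≈ h i) →
    sumR (map f (range a m)) ≈ sumR (map h (range a m))
  sumR-cong-range a zero    f≈h = refl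
  sumR-cong-range a (suc m) f≈h =
    +-cong (f≈h a ≤-refl) (sumR-cong-range (suc a) m (λ i a<i → f≈h i (≤-trans (n≤1+n a) a<i)))

  sumR-factor : ∀ {A : Set} {f g : A → Carrier} (a : Carrier) {xs} → All (λ x → f x ≈ a * g x) xs →
    sumR (map f xs) ≈ a * sumR (map g xs)
  sumR-factor a []           = sym (zeroʳ a)
  sumR-factor a (fx≈ ∷ rest) = trans (+-cong fx≈ (sumR-factor a rest)) (sym (distribˡ a _ _))

  pow-+ : ∀ x m n → pow x (m ℕ.+ n) ≈ pow x m * pow x n
  pow-+ x zero    n = sym (*-identityˡ _)
  pow-+ x (suc m) n = trans (*-congˡ (pow-+ x m n)) (sym (*-assoc _ _ _))

module Recurrence {c ℓ : Level} (R : CommutativeRing c ℓ) (k : ℕ)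
                  (z : Fin k → CommutativeRing.Carrier R) (q : CommutativeRing.Carrier R) where
  import Data.Nat as ℕ
  open import Data.Nat using (zero; suc; _∸_; _≤?_)
  open import Data.Nat.Combinatorics using (_C_)
  open import Data.Nat.Properties using (≤-refl; m∸n≤m)
  open import Data.Nat.ListAction using (sum)
  open import Data.List using (List; _∷_; map; concatMap)
  open import Data.List.Properties using (map-∘)
  import Data.List.Relation.Unary.All as All
  open import Relation.Nullary using (yes; no)
  import Relation.Binary.PropositionalEquality as P
  open CommutativeRing R
  open Poly R
  open RingSums R
  open import Relation.Binary.Reasoning.Setoid setoid
  open import Algebra.Properties.CommutativeSemigroup *-commutativeSemigroup using (interchange)

  weight : ℕ → List ℕ → Carrier
  weight n ls = prodR (map (zAt z) ls) * pow q (inv (prlp n ls))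

  layerFactor : ℕ → ℕ → Carrier
  layerFactor n j = zAt z (suc j) * pow q (j C 2 ℕ.+ suc j ℕ.* (n ∸ suc j))

  weight-cons : ∀ n j ls → sum ls P.≡ n ∸ suc j →
    weight n (suc j ∷ ls) ≈ layerFactor n j * weight (n ∸ suc j) ls
  weight-cons n j ls sum≡ = begin
    (zAt z (suc j) * prodR (map (zAt z) ls)) * pow q (inv (prlp n (suc j ∷ ls)))
      ≡⟨ P.cong (λ e → (zAt z (suc j) * prodR (map (zAt z) ls)) * pow q e) (inv-prlp-cons n j ls sum≡) ⟩
    (zAt z (suc j) * prodR (map (zAt z) ls)) * pow q (j C 2 ℕ.+ suc j ℕ.* (n ∸ suc j) ℕ.+ inv (prlp (n ∸ suc j) ls))
      ≈⟨ *-congˡ (pow-+ q (j C 2 ℕ.+ suc j ℕ.* (n ∸ suc j)) _) ⟩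
    (zAt z (suc j) * prodR (map (zAt z) ls)) * (pow q (j C 2 ℕ.+ suc j ℕ.* (n ∸ suc j)) * pow q (inv (prlp (n ∸ suc j) ls)))
      ≈⟨ interchange _ _ _ _ ⟩
    layerFactor n j * weight (n ∸ suc j) ls ∎

  layer-sum : ∀ n j →
    sumR (map (weight n) (map (suc j ∷_) (compositions k (n ∸ suc j)))) ≈ layerFactor n j * F k z q (n ∸ suc j)
  layer-sum n j = begin
    sumR (map (weight n) (map (suc j ∷_) (compositions k (n ∸ suc j))))
      ≡⟨ P.cong sumR (P.sym (map-∘ (compositions k (n ∸ suc j)))) ⟩
    sumR (map (λ ls → weight n (suc j ∷ ls)) (compositions k (n ∸ suc j)))
      ≈⟨ sumR-factor (layerFactor n j) (All.map (λ {ls} → weight-cons n j ls) (compositions-sum k (n ∸ suc j))) ⟩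
    layerFactor n j * F k z q (n ∸ suc j) ∎

  firstPart-sum : ∀ m i → 1 ≤ i → sumR (map (weight (suc m)) (firstPart k m m i (i ≤? suc m))) ≈ recTerm k z q (suc m) i
  firstPart-sum m (suc j) _ with suc j ≤? suc m
  ... | no  _ = refl
  ... | yes _ = begin
    sumR (map (weight (suc m)) (map (suc j ∷_) (compsFuel k m (m ∸ j))))
      ≡⟨ P.cong (λ L → sumR (map (weight (suc m)) (map (suc j ∷_) L))) (fuel-irrelevant k (m ∸ j) (m∸n≤m m j) ≤-refl) ⟩
    sumR (map (weight (suc m)) (map (suc j ∷_) (compositions k (m ∸ j))))
      ≈⟨ layer-sum (suc m) j ⟩
    layerFactor (suc m) j * F k z q (m ∸ j) ∎

  F-zero : F k z q 0 ≈ 1#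
  F-zero = trans (+-identityʳ _) (*-identityˡ _)

  F-suc : ∀ m → F k z q (suc m) ≈ recSum k z q (suc m)
  F-suc m = begin
    F k z q (suc m)
      ≡⟨ P.cong (λ L → sumR (map (weight (suc m)) L)) (compsFuel-suc k m m) ⟩
    sumR (map (weight (suc m)) (concatMap (λ i → firstPart k m m i (i ≤? suc m)) (range 1 k)))
      ≈⟨ sumR-concatMap (weight (suc m)) _ (range 1 k) ⟩
    sumR (map (λ i → sumR (map (weight (suc m)) (firstPart k m m i (i ≤? suc m)))) (range 1 k))
      ≈⟨ sumR-cong-range 1 k (firstPart-sum m) ⟩
    recSum k z q (suc m) ∎

open Recurrence using (F-zero; F-suc)

mainTheorem10 : {c ℓ : Level} (R : CommutativeRing c ℓ) (k : ℕ) → 1 ≤ k →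
    (z : Fin k → CommutativeRing.Carrier R) (q : CommutativeRing.Carrier R) →
    CommutativeRing._≈_ R (Poly.F R k z q 0) (CommutativeRing.1# R)
    × ((n : ℕ) → 1 ≤ n → CommutativeRing._≈_ R (Poly.F R k z q n) (Poly.recSum R k z q n))
mainTheorem10 R k _ z q = F-zero R k z q , λ { (suc m) _ → F-suc R k z q m }
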